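{- Let $n\ge 2$ and let $A=(a_{ij})\in\mathbb{R}^{n\times n}_{\ge 0}$ be a symmetric nonnegative matrix with at least one nonzero off-diagonal entry. Let $M_A$ be the matrix with rows indexed by the sets $S$ with $\emptyset\ne S\subsetneq[n]$ and columns indexed by the permutations $\pi\in\mathfrak{S}_n$, whose entry in row $S$ and column $\pi$ is $$\sum_{\substack{i\notin S,\ j\in S:\\ \pi(i)\le\pi(j)}} a_{ij}.$$ Then $\mathrm{hsb}(M_A)\le 4$.
   Context: The matrix $M_A$ is the slack matrix (possibly with repeated columns) of the graphic zonotope $Z(A) := \sum_{j} a_{jj}u^j + \sum_{i<j} a_{ij}[u^i,u^j]\subset\mathbb{R}^n$ (Minkowski sum; $u^i$ the unit vectors, $[x,y]$ the segment) with respect to its description $Z(A)=\{x : x([n])=g_A([n]),\ x(S)\ge g_A(S)\ \forall S\subseteq[n]\}$, where $g_A(S)=\sum_{i,j\in S,\, i\le j} a_{ij}$; the column of $\pi$ corresponds to the vertex $x^\pi$ with $x^\pi_j=\sum_{i:\pi(i)\le\pi(j)}a_{ij}$, and the entry is $x^\pi(S)-g_A(S)$. $\mathfrak{S}_n$ is the symmetric group on $[n]=\{1,\dots,n\}$. For a real matrix $M=(m_{ij})$, $\|M\| := \max_{i,j} |m_{ij}|$; $\langle X,Y\rangle := \sum_{i,j} x_{ij}y_{ij}$. Let $\mathcal{R}_{m,n}$ be the set of rank-one matrices in $\{0,1\}^{m\times n}$. For a nonnegative $S\in\mathbb{R}^{m\times n}_{\ge0}$ not identically zero, $\mathrm{hsb}(S)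 := \|S\|^{ -1}\max\{\langle S,X\rangle : X\in\mathbb{R}^{m\times n},\ \langle X,R\rangle\le 1\ \forall R\in\mathcal{R}_{m,n}\}$. -}

module Defs where

open import Level using (0ℓ) renaming (suc to lsuc)
open import Data.Bool using (Bool; true; false; if_then_else_; _∧_; not)
open import Data.Nat using (ℕ; zero; suc; _<ᵇ_; _≤ᵇ_)
open import Data.Fin using (Fin; toℕ; _≟_)
open import Data.Fin.Subset using (Subset; ∣_∣)
open import Data.Vec using (Vec; []; _∷_; lookup)
open import Data.List using (List; []; _∷_; [_]; map; _++_; foldr; filterᵇ; allFin; concatMap)
open import Data.List.Relation.Unary.Any using (Any)
open import Data.Product using (∃)
open import Relation.Nullary using (¬_; does)
open import Relation.Binary.PropositionalEquality using (_≡_)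
open import Relation.Binary.Structures using (IsDecTotalOrder)
open import Algebra.Bundles using (CommutativeRing)

-- A discrete (decidable) ordered field.  The real numbers are an
-- instance; the standard library has no reals, so the theorem is stated
-- for every such field.

record OrderedField : Set₁ where
  field
    commutativeRing : CommutativeRing 0ℓ 0ℓ
  open CommutativeRing commutativeRing public
  infix 4 _≤_
  field
    _≤_             : Carrier → Carrier → Set
    isDecTotalOrder : IsDecTotalOrder _≈_ _≤_
    +-monoˡ-≤       : ∀ {x y} z → x ≤ y → x + z ≤ y + z
    *-nonneg        : ∀ {x y} → 0# ≤ x → 0# ≤ y → 0# ≤ x * y
    0≉1             : ¬ (0# ≈ 1#)
    inverse         : ∀ x → ¬ (x ≈ 0#) → ∃ λ y → x * y ≈ 1#
  open IsDecTotalOrder isDecTotalOrder public using (_≤?_)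

module _ (F : OrderedField) where
  open OrderedField F

  sumL : {A : Set} → List A → (A → Carrier) → Carrier
  sumL xs f = foldr (λ x acc → f x + acc) 0# xs

  maxF : Carrier → Carrier → Carrier
  maxF a b = if does (a ≤? b) then b else a

  absF : Carrier → Carrier
  absF x = if does (x ≤? 0#) then - x else x

  four : Carrier
  four = 1# + 1# + 1# + 1#

  -- A matrix with rows indexed by the (duplicate-free) list rs and
  -- columns indexed by the (duplicate-free) list cs is a function R → C → F.

  -- ‖M‖ = max |m_rc|  (0 for an empty index set)
  norm : {R C : Set} → List R → List C → (R → C → Carrier) → Carrier
  norm rs cs M = foldr (λ r acc → foldr (λ c acc' → maxF (absF (M r c)) acc') acc cs) 0# rs

  inner : {R C : Set} → List R → List C → (R → C → Carrier) → (R → C → Carrier) → Carrier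
  inner rs cs X Y = sumL rs (λ r → sumL cs (λ c → X r c * Y r c))

  indicator : {R C : Set} → (R → Bool) → (C → Bool) → R → C → Carrier
  indicator I J r c = if I r ∧ J c then 1# else 0#

  -- 1_{I × J} is a rank-one 0/1 matrix iff I and J are nonempty; every
  -- rank-one 0/1 matrix is of this form.
  IsRankOne : {R C : Set} → List R → List C → (R → Bool) → (C → Bool) → Set
  IsRankOne rs cs I J = Any (λ r → I r ≡ true) rs Data.Product.× Any (λ c → J c ≡ true) cs

  -- hsb(M) ≤ c, i.e. max{⟨M,X⟩ : ⟨X,R⟩ ≤ 1 ∀ R ∈ 𝓡} ≤ c ‖M‖
  HsbLe : {R C : Set} → List R → List C → (R → C → Carrier) → Carrier → Set
  HsbLe rs cs M c =
    (X : _ → _ → Carrier) →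
    (∀ I J → IsRankOne rs cs I J → inner rs cs X (indicator I J) ≤ 1#) →
    inner rs cs M X ≤ c * norm rs cs M

allSubsets : (n : ℕ) → List (Subset n)
allSubsets zero    = [ [] ]
allSubsets (suc n) = map (true ∷_) (allSubsets n) ++ map (false ∷_) (allSubsets n)

properSubsets : (n : ℕ) → List (Subset n)
properSubsets n = filterᵇ (λ S → (0 <ᵇ ∣ S ∣) ∧ (∣ S ∣ <ᵇ n)) (allSubsets n)

allVecs : (n k : ℕ) → List (Vec (Fin n) k)
allVecs n zero    = [ [] ]
allVecs n (suc k) = concatMap (λ i → map (i ∷_) (allVecs n k)) (allFin n)

notIn : {n k : ℕ} → Fin n → Vec (Fin n) k → Bool
notIn i []       = true
notIn i (j ∷ js) = not (does (i ≟ j)) ∧ notIn i js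

distinct : {n k : ℕ} → Vec (Fin n) k → Bool
distinct []       = true
distinct (i ∷ is) = notIn i is ∧ distinct is

-- columns: the permutations π ∈ 𝔖ₙ, π given by its image vector (π(i) = lookup π i)
perms : (n : ℕ) → List (Vec (Fin n) n)
perms n = filterᵇ distinct (allVecs n n)

module _ (F : OrderedField) where
  open OrderedField F

  MA : {n : ℕ} → (Fin n → Fin n → Carrier) → Subset n → Vec (Fin n) n → Carrier
  MA {n} A S π =
    sumL F (allFin n) λ i → sumL F (allFin n) λ j →
      if not (lookup S i) ∧ lookup S j ∧ (toℕ (lookup π i) ≤ᵇ toℕ (lookup π j))
      then A i j else 0#

-- With I_ij = {S : i ∉ S, j ∈ S} and J_ij = {π : π(i) ≤ π(j)}, the matrix M_A is Σ_ij a_ij 1_{I_ij × J_ij}.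
-- Each 1_{I_ij × J_ij} is rank one or zero (I_ii = ∅), so every feasible X satisfies
-- ⟨M_A, X⟩ = Σ_ij a_ij ⟨X, 1_{I_ij × J_ij}⟩ ≤ Σ_{i≠j} a_ij. Placing the vertices one at a time on the side
-- of S that gains more crossing weight gives a cut with Σ_{i≠j} a_ij ≤ 4 cut(S), and a permutation listing
-- [n] ∖ S before S makes cut(S) an entry of M_A (unless S is ∅ or [n], where cut(S) = 0), so cut(S) ≤ ‖M_A‖.

{-# OPTIONS --safe #-}
module Submission where

open import Defs
open import Data.Bool using (Bool; true; false; if_then_else_; _∧_; not; T)
import Data.Bool as Bool
open import Data.Bool.Properties using (T-∧; T-≡; ∧-assoc; ∧-zeroʳ; ∧-inverseˡ)
open import Data.Nat as ℕ using (ℕ; zero; suc; _≥_)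
import Data.Nat.Properties as ℕ
open import Data.Fin as Fin using (Fin; toℕ; _≟_; fromℕ; inject₁)
import Data.Fin.Properties as Fin
open import Data.Fin.Subset using (Subset; ∣_∣; ⊥; ⊤)
open import Data.Fin.Subset.Properties using (∣p∣≤n; ∣p∣≡n⇒p≡⊤)
open import Data.Vec using (Vec; []; _∷_; lookup; map)
open import Data.Vec.Properties using (lookup-map; lookup-replicate)
open import Data.List using (List; []; _∷_; allFin; foldr)
open import Data.List.Properties using (map-tabulate; foldr-map)
open import Data.List.Relation.Unary.Any using (here; there; any?)
open import Data.List.Membership.Propositional using (_∈_; lose)
open import Data.List.Membership.Propositional.Properties
  using (∈-map⁺; ∈-concat⁺′; ∈-allFin; ∈-++⁺ˡ; ∈-++⁺ʳ; ∈-filter⁺)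
open import Data.Product using (_×_; _,_; ∃; ∃₂)
open import Data.Sum using (inj₁; inj₂)
open import Function using (_∘_; id)
open import Function.Bundles using (Equivalence)
open import Relation.Nullary using (¬_; does; yes; no; contradiction)
open import Relation.Nullary.Decidable using (T?; _×-dec_)
open import Relation.Binary.PropositionalEquality as ≡ using (_≡_; _≢_)
open import Relation.Binary.Bundles using (DecTotalOrder)

allSubsets-complete : ∀ {n} (S : Subset n) → S ∈ allSubsets n
allSubsets-complete []          = here ≡.refl
allSubsets-complete (true ∷ S)  = ∈-++⁺ˡ (∈-map⁺ _ (allSubsets-complete S))
allSubsets-complete (false ∷ S) = ∈-++⁺ʳ _ (∈-map⁺ _ (allSubsets-complete S))

∈-properSubsets : ∀ {n} {S : Subset n} → 0 ℕ.< ∣ S ∣ → ∣ S ∣ ℕ.< n → S ∈ properSubsets n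
∈-properSubsets 0<∣S∣ ∣S∣<n =
  ∈-filter⁺ (λ S → T? _) (allSubsets-complete _)
    (Equivalence.from T-∧ (ℕ.<⇒<ᵇ 0<∣S∣ , ℕ.<⇒<ᵇ ∣S∣<n))

∣p∣≡0⇒p≡⊥ : ∀ {n} {S : Subset n} → ∣ S ∣ ≡ 0 → S ≡ ⊥
∣p∣≡0⇒p≡⊥ {S = []}          _   = ≡.refl
∣p∣≡0⇒p≡⊥ {S = false ∷ S} ∣S∣≡0 = ≡.cong (false ∷_) (∣p∣≡0⇒p≡⊥ ∣S∣≡0)

allVecs-complete : ∀ {n k} (v : Vec (Fin n) k) → v ∈ allVecs n k
allVecs-complete []      = here ≡.refl
allVecs-complete (i ∷ v) = ∈-concat⁺′ (∈-map⁺ (i ∷_) (allVecs-complete v)) (∈-map⁺ _ (∈-allFin i))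

∈-perms : ∀ {n} {π : Vec (Fin n) n} → distinct π ≡ true → π ∈ perms n
∈-perms {π = π} distinct-π =
  ∈-filter⁺ (T? ∘ distinct) (allVecs-complete π) (≡.subst T (≡.sym distinct-π) _)

module _ {m k} {f : Fin m → Fin k} (f-injective : ∀ {i j} → f i ≡ f j → i ≡ j) where

  does-≟-injective : ∀ i j → does (f i ≟ f j) ≡ does (i ≟ j)
  does-≟-injective i j with i ≟ j | f i ≟ f j
  ... | yes _      | yes _        = ≡.refl
  ... | yes ≡.refl | no fi≢fj     = contradiction ≡.refl fi≢fj
  ... | no i≢j     | yes fi≡fj    = contradiction (f-injective fi≡fj) i≢j
  ... | no _       | no _         = ≡.refl

  notIn-map : ∀ {l} i (v : Vec (Fin m) l) → notIn (f i) (map f v) ≡ notIn i v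
  notIn-map i []      = ≡.refl
  notIn-map i (j ∷ v) = ≡.cong₂ (λ a b → not a ∧ b) (does-≟-injective i j) (notIn-map i v)

  distinct-map : ∀ {l} (v : Vec (Fin m) l) → distinct (map f v) ≡ distinct v
  distinct-map []      = ≡.refl
  distinct-map (i ∷ v) = ≡.cong₂ _∧_ (notIn-map i v) (distinct-map v)

notIn-map-fresh : ∀ {m k l} {f : Fin m → Fin k} {x} → (∀ j → x ≢ f j) →
                  (v : Vec (Fin m) l) → notIn x (map f v) ≡ true
notIn-map-fresh x-fresh []      = ≡.refl
notIn-map-fresh {f = f} {x} x-fresh (j ∷ v) with x ≟ f j
... | yes x≡fj = contradiction x≡fj (x-fresh j)
... | no _     = notIn-map-fresh x-fresh v

crosses : ∀ {n} → Fin n → Fin n → Subset n → Bool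
crosses i j S = not (lookup S i) ∧ lookup S j

precedes : ∀ {n} → Fin n → Fin n → Vec (Fin n) n → Bool
precedes i j π = toℕ (lookup π i) ℕ.≤ᵇ toℕ (lookup π j)

Separates : ∀ {n} → Subset n → Vec (Fin n) n → Set
Separates S π = ∀ i j → lookup S i ≡ false → lookup S j ≡ true → lookup π i Fin.≤ lookup π j

inject₁-mono-≤ : ∀ {n} {i j : Fin n} → i Fin.≤ j → inject₁ i Fin.≤ inject₁ j
inject₁-mono-≤ {i = i} {j} =
  ≡.subst₂ ℕ._≤_ (≡.sym (Fin.toℕ-inject₁ i)) (≡.sym (Fin.toℕ-inject₁ j))

separatingPerm : ∀ {n} (S : Subset n) → ∃ λ π → distinct π ≡ true × Separates S π
separatingPerm [] = [] , ≡.refl , λ ()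
separatingPerm {suc n} (true ∷ S) with separatingPerm S
... | π , distinct-π , sep =
  fromℕ n ∷ map inject₁ π ,
  ≡.cong₂ _∧_ (notIn-map-fresh (λ j → Fin.fromℕ≢inject₁) π)
              (≡.trans (distinct-map Fin.inject₁-injective π) distinct-π) ,
  separates
  where
  separates : Separates (true ∷ S) (fromℕ n ∷ map inject₁ π)
  separates Fin.zero _ ()
  separates (Fin.suc i) Fin.zero _ _ = Fin.≤fromℕ _
  separates (Fin.suc i) (Fin.suc j) i∉S j∈S
    rewrite lookup-map i inject₁ π | lookup-map j inject₁ π = inject₁-mono-≤ (sep i j i∉S j∈S)
separatingPerm (false ∷ S) with separatingPerm S
... | π , distinct-π , sep =
  Fin.zero ∷ map Fin.suc π ,
  ≡.cong₂ _∧_ (notIn-map-fresh (λ j ()) π) (≡.trans (distinct-map Fin.suc-injective π) distinct-π) ,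
  separates
  where
  separates : Separates (false ∷ S) (Fin.zero ∷ map Fin.suc π)
  separates _ Fin.zero _ ()
  separates Fin.zero (Fin.suc j) _ _ = ℕ.z≤n
  separates (Fin.suc i) (Fin.suc j) i∉S j∈S
    rewrite lookup-map i Fin.suc π | lookup-map j Fin.suc π = ℕ.s≤s (sep i j i∉S j∈S)

module _ (F : OrderedField) where
  open OrderedField F

  decTotalOrder : DecTotalOrder _ _ _
  decTotalOrder = record { isDecTotalOrder = isDecTotalOrder }

  open DecTotalOrder decTotalOrder using (poset; total)
    renaming (refl to ≤-refl; reflexive to ≤-reflexive; trans to ≤-trans)
  open import Relation.Binary.Reasoning.PartialOrder poset
  open import Algebra.Properties.CommutativeSemigroup +-commutativeSemigroup using (interchange)
  open import Algebra.Properties.Group +-group using (//-rightDividesˡ)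

  +-monoʳ-≤ : ∀ {x y} z → x ≤ y → z + x ≤ z + y
  +-monoʳ-≤ {x} {y} z x≤y = begin
    z + x ≈⟨ +-comm z x ⟩
    x + z ≤⟨ +-monoˡ-≤ z x≤y ⟩
    y + z ≈⟨ +-comm y z ⟩
    z + y ∎

  +-mono-≤ : ∀ {x y u v} → x ≤ y → u ≤ v → x + u ≤ y + v
  +-mono-≤ {y = y} {u} x≤y u≤v = ≤-trans (+-monoˡ-≤ u x≤y) (+-monoʳ-≤ y u≤v)

  x≤0⇒0≤-x : ∀ {x} → x ≤ 0# → 0# ≤ - x
  x≤0⇒0≤-x {x} x≤0 = begin
    0#       ≈⟨ -‿inverseʳ x ⟨
    x + - x  ≤⟨ +-monoˡ-≤ (- x) x≤0 ⟩
    0# + - x ≈⟨ +-identityˡ (- x) ⟩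
    - x      ∎

  x≤y⇒0≤y-x : ∀ {x y} → x ≤ y → 0# ≤ y - x
  x≤y⇒0≤y-x {x} {y} x≤y = begin
    0#     ≈⟨ -‿inverseʳ x ⟨
    x - x  ≤⟨ +-monoˡ-≤ (- x) x≤y ⟩
    y - x  ∎

  *-monoˡ-≤-nonneg : ∀ {a x y} → 0# ≤ a → x ≤ y → a * x ≤ a * y
  *-monoˡ-≤-nonneg {a} {x} {y} 0≤a x≤y = begin
    a * x                ≈⟨ +-identityˡ (a * x) ⟨
    0# + a * x           ≤⟨ +-monoˡ-≤ (a * x) (*-nonneg 0≤a (x≤y⇒0≤y-x x≤y)) ⟩
    a * (y - x) + a * x  ≈⟨ distribˡ a (y - x) x ⟨
    a * ((y - x) + x)    ≈⟨ *-congˡ (//-rightDividesˡ x y) ⟩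
    a * y                ∎

  x≤maxF : ∀ x y → x ≤ maxF F x y
  x≤maxF x y with x ≤? y
  ... | yes x≤y = x≤y
  ... | no  _   = ≤-refl

  y≤maxF : ∀ x y → y ≤ maxF F x y
  y≤maxF x y with x ≤? y | total x y
  ... | yes _   | _       = ≤-refl
  ... | no  x≰y | inj₁ x≤y = contradiction x≤y x≰y
  ... | no  _   | inj₂ y≤x = y≤x

  x≤absF : ∀ x → x ≤ absF F x
  x≤absF x with x ≤? 0#
  ... | yes x≤0 = ≤-trans x≤0 (x≤0⇒0≤-x x≤0)
  ... | no  _   = ≤-refl

  ∑ : {A : Set} → List A → (A → Carrier) → Carrier
  ∑ = sumL F

  infix 5 ∑
  syntax ∑ xs (λ x → e) = ∑[ x ∈ xs ] e

  module _ {K : Set} where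

    ∑-cong : (xs : List K) {f g : K → Carrier} → (∀ x → f x ≈ g x) → ∑ xs f ≈ ∑ xs g
    ∑-cong []       f≈g = refl
    ∑-cong (x ∷ xs) f≈g = +-cong (f≈g x) (∑-cong xs f≈g)

    ∑-mono-≤ : (xs : List K) {f g : K → Carrier} → (∀ x → f x ≤ g x) → ∑ xs f ≤ ∑ xs g
    ∑-mono-≤ []       f≤g = ≤-refl
    ∑-mono-≤ (x ∷ xs) f≤g = +-mono-≤ (f≤g x) (∑-mono-≤ xs f≤g)

    ∑-zero : (xs : List K) {f : K → Carrier} → (∀ {x} → x ∈ xs → f x ≈ 0#) → ∑ xs f ≈ 0#
    ∑-zero []       f≈0 = refl
    ∑-zero (x ∷ xs) f≈0 = trans (+-cong (f≈0 (here ≡.refl)) (∑-zero xs (f≈0 ∘ there))) (+-identityˡ 0#)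

    ∑-distrib-+ : (xs : List K) (f g : K → Carrier) → ∑[ x ∈ xs ] (f x + g x) ≈ ∑ xs f + ∑ xs g
    ∑-distrib-+ []       f g = sym (+-identityˡ 0#)
    ∑-distrib-+ (x ∷ xs) f g = trans (+-congˡ (∑-distrib-+ xs f g)) (interchange _ _ _ _)

    *-distribˡ-∑ : (a : Carrier) (xs : List K) (f : K → Carrier) → a * ∑ xs f ≈ ∑[ x ∈ xs ] (a * f x)
    *-distribˡ-∑ a []       f = zeroʳ a
    *-distribˡ-∑ a (x ∷ xs) f = trans (distribˡ a _ _) (+-congˡ (*-distribˡ-∑ a xs f))

    *-distribʳ-∑ : (a : Carrier) (xs : List K) (f : K → Carrier) → ∑ xs f * a ≈ ∑[ x ∈ xs ] (f x * a)
    *-distribʳ-∑ a []       f = zeroˡ a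
    *-distribʳ-∑ a (x ∷ xs) f = trans (distribʳ a _ _) (+-congˡ (*-distribʳ-∑ a xs f))

  ∑-comm : {A B : Set} (xs : List A) (ys : List B) (f : A → B → Carrier) →
           ∑[ x ∈ xs ] ∑[ y ∈ ys ] f x y ≈ ∑[ y ∈ ys ] ∑[ x ∈ xs ] f x y
  ∑-comm []       ys f = sym (∑-zero ys (λ _ → refl))
  ∑-comm (x ∷ xs) ys f = trans (+-congˡ (∑-comm xs ys f)) (sym (∑-distrib-+ ys (f x) _))

  ∑-allFin-suc : ∀ {n} (f : Fin (suc n) → Carrier) →
                 ∑ (allFin (suc n)) f ≡ f Fin.zero + (∑[ i ∈ allFin n ] f (Fin.suc i))
  ∑-allFin-suc {n} f = ≡.cong (f Fin.zero +_)
    (≡.trans (≡.cong (λ xs → ∑ xs f) (≡.sym (map-tabulate id Fin.suc))) (foldr-map _ Fin.suc 0# (allFin n)))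

  module _ {Y : Set} (step : Y → Carrier → Carrier)
           (step-inflationary : ∀ y acc → acc ≤ step y acc) where

    foldr-inflationary : ∀ acc ys → acc ≤ foldr step acc ys
    foldr-inflationary acc []       = ≤-refl
    foldr-inflationary acc (y ∷ ys) = ≤-trans (foldr-inflationary acc ys) (step-inflationary y _)

    foldr-≥-step : {h : Y → Carrier} → (∀ y acc → h y ≤ step y acc) →
                   ∀ acc {y ys} → y ∈ ys → h y ≤ foldr step acc ys
    foldr-≥-step h≤step acc (here ≡.refl)          = h≤step _ _
    foldr-≥-step h≤step acc {ys = y′ ∷ _} (there y∈ys) =
      ≤-trans (foldr-≥-step h≤step acc y∈ys) (step-inflationary y′ _)

  Feasible : {R C : Set} → List R → List C → (R → C → Carrier) → Set
  Feasible rs cs X = ∀ I J → IsRankOne F rs cs I J → inner F rs cs X (indicator F I J) ≤ 1#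

  module _ {R C : Set} (rs : List R) (cs : List C) where

    module _ (M : R → C → Carrier) where

      private
        rowStep : R → Carrier → Carrier
        rowStep r acc = foldr (λ c → maxF F (absF F (M r c))) acc cs

        rowStep-inflationary : ∀ r acc → acc ≤ rowStep r acc
        rowStep-inflationary r acc = foldr-inflationary _ (λ c → y≤maxF _) acc cs

      norm-nonneg : 0# ≤ norm F rs cs M
      norm-nonneg = foldr-inflationary rowStep rowStep-inflationary 0# rs

      ≤-norm : ∀ {r c} → r ∈ rs → c ∈ cs → M r c ≤ norm F rs cs M
      ≤-norm {c = c} r∈rs c∈cs = foldr-≥-step rowStep rowStep-inflationary entry≤rowStep 0# r∈rs
        where
        entry≤rowStep : ∀ r acc → M r c ≤ rowStep r acc
        entry≤rowStep r acc = foldr-≥-step _ (λ c → y≤maxF _)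
          (λ c acc → ≤-trans (x≤absF (M r c)) (x≤maxF _ acc)) acc c∈cs

    inner-congˡ : {M N : R → C → Carrier} (X : R → C → Carrier) → (∀ r c → M r c ≈ N r c) →
                  inner F rs cs M X ≈ inner F rs cs N X
    inner-congˡ X M≈N = ∑-cong rs λ r → ∑-cong cs λ c → *-congʳ (M≈N r c)

    inner-∑ˡ : {K : Set} (ks : List K) (N : K → R → C → Carrier) (X : R → C → Carrier) →
               inner F rs cs (λ r c → ∑[ k ∈ ks ] N k r c) X ≈ ∑[ k ∈ ks ] inner F rs cs (N k) X
    inner-∑ˡ ks N X = begin-equality
      ∑[ r ∈ rs ] ∑[ c ∈ cs ] (∑[ k ∈ ks ] N k r c) * X r c
        ≈⟨ ∑-cong rs (λ r → ∑-cong cs λ c → *-distribʳ-∑ (X r c) ks _) ⟩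
      ∑[ r ∈ rs ] ∑[ c ∈ cs ] ∑[ k ∈ ks ] N k r c * X r c
        ≈⟨ ∑-cong rs (λ r → ∑-comm cs ks _) ⟩
      ∑[ r ∈ rs ] ∑[ k ∈ ks ] ∑[ c ∈ cs ] N k r c * X r c
        ≈⟨ ∑-comm rs ks _ ⟩
      ∑[ k ∈ ks ] ∑[ r ∈ rs ] ∑[ c ∈ cs ] N k r c * X r c ∎

    inner-if-indicator : (I : R → Bool) (J : C → Bool) (a : Carrier) (X : R → C → Carrier) →
      inner F rs cs (λ r c → if I r ∧ J c then a else 0#) X ≈ a * inner F rs cs X (indicator F I J)
    inner-if-indicator I J a X = begin-equality
      ∑[ r ∈ rs ] ∑[ c ∈ cs ] (if I r ∧ J c then a else 0#) * X r c
        ≈⟨ ∑-cong rs (λ r → ∑-cong cs λ c → if-scale (I r ∧ J c) (X r c)) ⟩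
      ∑[ r ∈ rs ] ∑[ c ∈ cs ] a * (X r c * indicator F I J r c)
        ≈⟨ ∑-cong rs (λ r → *-distribˡ-∑ a cs _) ⟨
      ∑[ r ∈ rs ] a * (∑[ c ∈ cs ] X r c * indicator F I J r c)
        ≈⟨ *-distribˡ-∑ a rs _ ⟨
      a * inner F rs cs X (indicator F I J) ∎
      where
      if-scale : ∀ b x → (if b then a else 0#) * x ≈ a * (x * (if b then 1# else 0#))
      if-scale true  x = *-congˡ (sym (*-identityʳ x))
      if-scale false x = trans (zeroˡ x) (sym (trans (*-congˡ (zeroʳ x)) (zeroʳ a)))

    module _ (I : R → Bool) (J : C → Bool) (X : R → C → Carrier) where

      inner-indicator-disjoint : (∀ {r c} → r ∈ rs → c ∈ cs → I r ∧ J c ≡ false) →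
                                 inner F rs cs X (indicator F I J) ≈ 0#
      inner-indicator-disjoint I∧J≡false = ∑-zero rs λ r∈rs → ∑-zero cs λ c∈cs →
        trans (*-congˡ (reflexive (≡.cong (if_then 1# else 0#) (I∧J≡false r∈rs c∈cs)))) (zeroʳ _)

      ¬IsRankOne⇒disjoint : ¬ IsRankOne F rs cs I J →
                            ∀ {r c} → r ∈ rs → c ∈ cs → I r ∧ J c ≡ false
      ¬IsRankOne⇒disjoint ¬rankOne {r} {c} r∈rs c∈cs with I r in Ir | J c in Jc
      ... | false | _     = ≡.refl
      ... | true  | false = ≡.refl
      ... | true  | true  = contradiction (lose r∈rs Ir , lose c∈cs Jc) ¬rankOne

      feasible⇒scaled-indicator≤ : Feasible rs cs X → ∀ {a} → 0# ≤ a →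
                                   a * inner F rs cs X (indicator F I J) ≤ a
      feasible⇒scaled-indicator≤ feasible {a} 0≤a
        with any? (λ r → I r Bool.≟ true) rs ×-dec any? (λ c → J c Bool.≟ true) cs
      ... | yes rankOne = begin
        a * inner F rs cs X (indicator F I J) ≤⟨ *-monoˡ-≤-nonneg 0≤a (feasible I J rankOne) ⟩
        a * 1#                                 ≈⟨ *-identityʳ a ⟩
        a                                      ∎
      ... | no ¬rankOne = begin
        a * inner F rs cs X (indicator F I J) ≈⟨ *-congˡ (inner-indicator-disjoint
                                                     (¬IsRankOne⇒disjoint ¬rankOne)) ⟩
        a * 0#                                 ≈⟨ zeroʳ a ⟩
        0#                                     ≤⟨ 0≤a ⟩
        a                                      ∎

  ∑²-allFin-suc : ∀ {n} (f : Fin (suc n) → Fin (suc n) → Carrier) →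
    ∑[ i ∈ allFin (suc n) ] ∑[ j ∈ allFin (suc n) ] f i j ≈
    (f Fin.zero Fin.zero + (∑[ j ∈ allFin n ] f Fin.zero (Fin.suc j))) +
    ((∑[ i ∈ allFin n ] f (Fin.suc i) Fin.zero) +
     (∑[ i ∈ allFin n ] ∑[ j ∈ allFin n ] f (Fin.suc i) (Fin.suc j)))
  ∑²-allFin-suc {n} f =
    trans (reflexive (∑-allFin-suc (λ i → ∑[ j ∈ allFin (suc n) ] f i j)))
      (+-cong (reflexive (∑-allFin-suc (f Fin.zero)))
        (trans (∑-cong (allFin n) λ i → reflexive (∑-allFin-suc (f (Fin.suc i))))
               (∑-distrib-+ (allFin n) _ _)))

  twice : Carrier → Carrier
  twice x = x + x

  twice-mono-≤ : ∀ {x y} → x ≤ y → twice x ≤ twice y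
  twice-mono-≤ x≤y = +-mono-≤ x≤y x≤y

  twice-cong : ∀ {x y} → x ≈ y → twice x ≈ twice y
  twice-cong x≈y = +-cong x≈y x≈y

  twice-distrib-+ : ∀ x y → twice (x + y) ≈ twice x + twice y
  twice-distrib-+ x y = interchange x y x y

  twice²-distrib-+ : ∀ x y → twice (twice (x + y)) ≈ twice (twice x) + twice (twice y)
  twice²-distrib-+ x y = trans (twice-cong (twice-distrib-+ x y)) (twice-distrib-+ (twice x) (twice y))

  four*≈twice-twice : ∀ x → four F * x ≈ twice (twice x)
  four*≈twice-twice x = begin-equality
    (((1# + 1#) + 1#) + 1#) * x             ≈⟨ distribʳ x _ _ ⟩
    ((1# + 1#) + 1#) * x + 1# * x           ≈⟨ +-congʳ (distribʳ x _ _) ⟩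
    ((1# + 1#) * x + 1# * x) + 1# * x       ≈⟨ +-congʳ (+-congʳ (distribʳ x _ _)) ⟩
    ((1# * x + 1# * x) + 1# * x) + 1# * x   ≈⟨ +-cong (+-cong (+-cong 1x≈x 1x≈x) 1x≈x) 1x≈x ⟩
    ((x + x) + x) + x                       ≈⟨ +-assoc (x + x) x x ⟩
    twice (twice x)                         ∎
    where
    1x≈x : 1# * x ≈ x
    1x≈x = *-identityˡ x

  module _ {n : ℕ} (A : Fin n → Fin n → Carrier) where

    crossing : Subset n → Fin n → Fin n → Carrier
    crossing S i j = if crosses i j S then A i j else 0#

    cut : Subset n → Carrier
    cut S = ∑[ i ∈ allFin n ] ∑[ j ∈ allFin n ] crossing S i j

    offDiagonalWeight : Carrier
    offDiagonalWeight = ∑[ i ∈ allFin n ] ∑[ j ∈ allFin n ] (if does (i ≟ j) then 0# else A i j)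

  deleteVertex₀ : ∀ {n} → (Fin (suc n) → Fin (suc n) → Carrier) → Fin n → Fin n → Carrier
  deleteVertex₀ A i j = A (Fin.suc i) (Fin.suc j)

  module _ {n : ℕ} (A : Fin (suc n) → Fin (suc n) → Carrier) (S : Subset n) where

    private
      A′ : Fin n → Fin n → Carrier
      A′ = deleteVertex₀ A

    gainOutside : Carrier
    gainOutside = ∑[ j ∈ allFin n ] crossing A (false ∷ S) Fin.zero (Fin.suc j)

    gainInside : Carrier
    gainInside = ∑[ i ∈ allFin n ] crossing A (true ∷ S) (Fin.suc i) Fin.zero

    cut-false∷ : cut A (false ∷ S) ≈ gainOutside + cut A′ S
    cut-false∷ = begin-equality
      cut A (false ∷ S)
        ≈⟨ ∑²-allFin-suc (crossing A (false ∷ S)) ⟩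
      (0# + gainOutside) + (_ + cut A′ S)
        ≈⟨ +-cong (+-identityˡ _) (+-congʳ (∑-zero (allFin n) λ {i} _ →
             reflexive (≡.cong (if_then _ else 0#) (∧-zeroʳ (not (lookup S i)))))) ⟩
      gainOutside + (0# + cut A′ S)
        ≈⟨ +-congˡ (+-identityˡ _) ⟩
      gainOutside + cut A′ S ∎

    cut-true∷ : cut A (true ∷ S) ≈ gainInside + cut A′ S
    cut-true∷ = begin-equality
      cut A (true ∷ S)
        ≈⟨ ∑²-allFin-suc (crossing A (true ∷ S)) ⟩
      (0# + _) + (gainInside + cut A′ S)
        ≈⟨ +-congʳ (trans (+-identityˡ _) (∑-zero (allFin n) (λ _ → refl))) ⟩
      0# + (gainInside + cut A′ S)
        ≈⟨ +-identityˡ _ ⟩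
      gainInside + cut A′ S ∎

    offDiagonalWeight-suc : (∀ i j → A i j ≈ A j i) →
      offDiagonalWeight A ≈ twice (gainOutside + gainInside) + offDiagonalWeight A′
    offDiagonalWeight-suc A-sym = begin-equality
      offDiagonalWeight A
        ≈⟨ ∑²-allFin-suc (λ i j → if does (i ≟ j) then 0# else A i j) ⟩
      (0# + edges₀) + ((∑[ i ∈ allFin n ] A (Fin.suc i) Fin.zero) + offDiagonalWeight A′)
        ≈⟨ +-cong (+-identityˡ _) (+-congʳ (∑-cong (allFin n) λ i → A-sym _ _)) ⟩
      edges₀ + (edges₀ + offDiagonalWeight A′)
        ≈⟨ +-assoc _ _ _ ⟨
      twice edges₀ + offDiagonalWeight A′
        ≈⟨ +-congʳ (+-cong edges₀-split edges₀-split) ⟩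
      twice (gainOutside + gainInside) + offDiagonalWeight A′ ∎
      where
      edges₀ : Carrier
      edges₀ = ∑[ j ∈ allFin n ] A Fin.zero (Fin.suc j)

      edge-split : ∀ j → A Fin.zero (Fin.suc j) ≈
        crossing A (false ∷ S) Fin.zero (Fin.suc j) + crossing A (true ∷ S) (Fin.suc j) Fin.zero
      edge-split j with lookup S j
      ... | true  = sym (+-identityʳ _)
      ... | false = trans (A-sym _ _) (sym (+-identityˡ _))

      edges₀-split : edges₀ ≈ gainOutside + gainInside
      edges₀-split = trans (∑-cong (allFin n) edge-split) (∑-distrib-+ (allFin n) _ _)

    offDiagonalWeight≤4cut-step : (∀ i j → A i j ≈ A j i) →
      offDiagonalWeight A′ ≤ twice (twice (cut A′ S)) →
      ∀ {e c} → gainOutside + gainInside ≤ twice e → c ≈ e + cut A′ S →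
      offDiagonalWeight A ≤ twice (twice c)
    offDiagonalWeight≤4cut-step A-sym W′≤4cut′ {e} {c} gains≤2e c≈e+cut′ = begin
      offDiagonalWeight A
        ≈⟨ offDiagonalWeight-suc A-sym ⟩
      twice (gainOutside + gainInside) + offDiagonalWeight A′
        ≤⟨ +-mono-≤ (twice-mono-≤ gains≤2e) W′≤4cut′ ⟩
      twice (twice e) + twice (twice (cut A′ S))
        ≈⟨ twice²-distrib-+ e (cut A′ S) ⟨
      twice (twice (e + cut A′ S))
        ≈⟨ twice-cong (twice-cong c≈e+cut′) ⟨
      twice (twice c) ∎

  largeCut : ∀ {n} (A : Fin n → Fin n → Carrier) → (∀ i j → A i j ≈ A j i) →
             ∃ λ S → offDiagonalWeight A ≤ twice (twice (cut A S))
  largeCut {zero} A _ = [] , ≤-reflexive (sym (trans (+-cong 0+0≈0 0+0≈0) 0+0≈0))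
    where
    0+0≈0 : 0# + 0# ≈ 0#
    0+0≈0 = +-identityˡ 0#
  largeCut {suc n} A A-sym with largeCut (deleteVertex₀ A) (λ i j → A-sym _ _)
  ... | S , W′≤4cut′ with total (gainOutside A S) (gainInside A S)
  ... | inj₁ outside≤inside = true ∷ S ,
        offDiagonalWeight≤4cut-step A S A-sym W′≤4cut′ (+-monoˡ-≤ _ outside≤inside) (cut-true∷ A S)
  ... | inj₂ inside≤outside = false ∷ S ,
        offDiagonalWeight≤4cut-step A S A-sym W′≤4cut′ (+-monoʳ-≤ _ inside≤outside) (cut-false∷ A S)

  module _ {n : ℕ} (A : Fin n → Fin n → Carrier) where

    MA≈cut : ∀ S π → Separates S π → MA F A S π ≈ cut A S
    MA≈cut S π sep = ∑-cong (allFin n) λ i → ∑-cong (allFin n) λ j → entry i j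
      where
      entry : ∀ i j → (if not (lookup S i) ∧ lookup S j ∧ precedes i j π then A i j else 0#) ≈
                      crossing A S i j
      entry i j with lookup S i in i∉S | lookup S j in j∈S
      ... | true  | _     = refl
      ... | false | false = refl
      ... | false | true  rewrite Equivalence.to T-≡ (ℕ.≤⇒≤ᵇ (sep i j i∉S j∈S)) = refl

    cut-noCrossing : ∀ S → (∀ i j → crosses i j S ≡ false) → cut A S ≈ 0#
    cut-noCrossing S noCrossing = ∑-zero (allFin n) λ {i} _ → ∑-zero (allFin n) λ {j} _ →
      reflexive (≡.cong (if_then A i j else 0#) (noCrossing i j))

    cut-empty : ∀ S → ∣ S ∣ ≡ 0 → cut A S ≈ 0#
    cut-empty S ∣S∣≡0 with ∣p∣≡0⇒p≡⊥ {S = S} ∣S∣≡0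
    ... | ≡.refl = cut-noCrossing ⊥ λ i j →
      ≡.trans (≡.cong (not (lookup ⊥ i) ∧_) (lookup-replicate j false)) (∧-zeroʳ _)

    cut-full : ∀ S → ∣ S ∣ ≡ n → cut A S ≈ 0#
    cut-full S ∣S∣≡n with ∣p∣≡n⇒p≡⊤ {p = S} ∣S∣≡n
    ... | ≡.refl = cut-noCrossing ⊤ λ i j → ≡.cong (λ b → not b ∧ lookup ⊤ j) (lookup-replicate i true)

    ‖MA‖ : Carrier
    ‖MA‖ = norm F (properSubsets n) (perms n) (MA F A)

    cut≤‖MA‖ : ∀ S π → distinct π ≡ true → Separates S π → cut A S ≤ ‖MA‖
    cut≤‖MA‖ S π distinct-π sep with ∣ S ∣ ℕ.≟ 0 | ∣ S ∣ ℕ.≟ n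
    ... | yes ∣S∣≡0 | _        = ≤-trans (≤-reflexive (cut-empty S ∣S∣≡0)) ‖MA‖-nonneg
      where ‖MA‖-nonneg = norm-nonneg (properSubsets n) (perms n) (MA F A)
    ... | no _     | yes ∣S∣≡n = ≤-trans (≤-reflexive (cut-full S ∣S∣≡n)) ‖MA‖-nonneg
      where ‖MA‖-nonneg = norm-nonneg (properSubsets n) (perms n) (MA F A)
    ... | no ∣S∣≢0 | no ∣S∣≢n = begin
      cut A S     ≈⟨ MA≈cut S π sep ⟨
      MA F A S π  ≤⟨ ≤-norm (properSubsets n) (perms n) (MA F A) S-proper π-perm ⟩
      ‖MA‖        ∎
      where
      S-proper : S ∈ properSubsets n
      S-proper = ∈-properSubsets (ℕ.n≢0⇒n>0 ∣S∣≢0) (ℕ.≤∧≢⇒< (∣p∣≤n S) ∣S∣≢n)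

      π-perm : π ∈ perms n
      π-perm = ∈-perms distinct-π

    edgeIndicator : Fin n → Fin n → Subset n → Vec (Fin n) n → Carrier
    edgeIndicator i j = indicator F (crosses i j) (precedes i j)

    module _ (rs : List (Subset n)) (cs : List (Vec (Fin n) n))
             (X : Subset n → Vec (Fin n) n → Carrier) where

      inner-MA : inner F rs cs (MA F A) X ≈
        ∑[ i ∈ allFin n ] ∑[ j ∈ allFin n ] A i j * inner F rs cs X (edgeIndicator i j)
      inner-MA = begin-equality
        inner F rs cs (MA F A) X
          ≈⟨ inner-congˡ rs cs X (λ S π → ∑-cong (allFin n) λ i → ∑-cong (allFin n) λ j →
               reflexive (≡.cong (if_then A i j else 0#) (≡.sym (∧-assoc (not (lookup S i)) _ _)))) ⟩
        inner F rs cs (λ S π → ∑[ i ∈ allFin n ] ∑[ j ∈ allFin n ] term i j S π) X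
          ≈⟨ inner-∑ˡ rs cs (allFin n) _ X ⟩
        ∑[ i ∈ allFin n ] inner F rs cs (λ S π → ∑[ j ∈ allFin n ] term i j S π) X
          ≈⟨ ∑-cong (allFin n) (λ i → inner-∑ˡ rs cs (allFin n) (term i) X) ⟩
        ∑[ i ∈ allFin n ] ∑[ j ∈ allFin n ] inner F rs cs (term i j) X
          ≈⟨ ∑-cong (allFin n) (λ i → ∑-cong (allFin n) λ j →
               inner-if-indicator rs cs (crosses i j) (precedes i j) (A i j) X) ⟩
        ∑[ i ∈ allFin n ] ∑[ j ∈ allFin n ] A i j * inner F rs cs X (edgeIndicator i j) ∎
        where
        term : Fin n → Fin n → Subset n → Vec (Fin n) n → Carrier
        term i j S π = if crosses i j S ∧ precedes i j π then A i j else 0#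

      inner-MA≤offDiagonalWeight : (∀ i j → 0# ≤ A i j) → Feasible rs cs X →
                                   inner F rs cs (MA F A) X ≤ offDiagonalWeight A
      inner-MA≤offDiagonalWeight A-nonneg feasible = begin
        inner F rs cs (MA F A) X
          ≈⟨ inner-MA ⟩
        ∑[ i ∈ allFin n ] ∑[ j ∈ allFin n ] A i j * inner F rs cs X (edgeIndicator i j)
          ≤⟨ ∑-mono-≤ (allFin n) (λ i → ∑-mono-≤ (allFin n) (term≤ i)) ⟩
        offDiagonalWeight A ∎
        where
        term≤ : ∀ i j → A i j * inner F rs cs X (edgeIndicator i j) ≤
                        (if does (i ≟ j) then 0# else A i j)
        term≤ i j with i ≟ j
        ... | yes ≡.refl = ≤-reflexive (trans (*-congˡ no-crossing) (zeroʳ _))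
          where
          no-crossing : inner F rs cs X (edgeIndicator i i) ≈ 0#
          no-crossing = inner-indicator-disjoint rs cs (crosses i i) (precedes i i) X
            λ {S} {π} _ _ → ≡.cong (_∧ precedes i i π) (∧-inverseˡ (lookup S i))
        ... | no _ = feasible⇒scaled-indicator≤ rs cs (crosses i j) (precedes i j) X feasible (A-nonneg i j)

    hsb-MA≤4 : (∀ i j → A i j ≈ A j i) → (∀ i j → 0# ≤ A i j) →
               HsbLe F (properSubsets n) (perms n) (MA F A) (four F)
    hsb-MA≤4 A-sym A-nonneg X feasible with largeCut A A-sym
    ... | S , W≤4cut with separatingPerm S
    ... | π , distinct-π , sep = begin
      inner F (properSubsets n) (perms n) (MA F A) X
        ≤⟨ inner-MA≤offDiagonalWeight (properSubsets n) (perms n) X A-nonneg feasible ⟩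
      offDiagonalWeight A
        ≤⟨ W≤4cut ⟩
      twice (twice (cut A S))
        ≤⟨ twice-mono-≤ (twice-mono-≤ (cut≤‖MA‖ S π distinct-π sep)) ⟩
      twice (twice ‖MA‖)
        ≈⟨ four*≈twice-twice ‖MA‖ ⟨
      four F * ‖MA‖ ∎

-- The hypotheses n ≥ 2 and "some off-diagonal a_ij ≠ 0" only ensure M_A ≠ 0, so that hsb(M_A) is defined;
-- the inequality ⟨M_A, X⟩ ≤ 4‖M_A‖ behind it holds without them.
theorem4p2 : (F : OrderedField) → let open OrderedField F in
    (n : ℕ) → n ≥ 2 →
    (A : Fin n → Fin n → Carrier) →
    (∀ i j → A i j ≈ A j i) →
    (∀ i j → 0# ≤ A i j) →
    (∃₂ λ i j → i ≢ j × ¬ (A i j ≈ 0#)) →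
    HsbLe F (properSubsets n) (perms n) (MA F A) (four F)
theorem4p2 F n _ A A-sym A-nonneg _ = hsb-MA≤4 F A A-sym A-nonneg
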